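{- Let $k\ge 1$ be an integer, let $G$ be a finite simple graph, and let $H$ be a hamiltonian subgraph of $G$. Suppose that there exists a vertex $x_0\in V(H)$ with $\deg_H(x_0)\ge k$. Then $H$ (and hence $G$) contains every $k$-spider as a subgraph.
   Context: A spider is a tree with at most one vertex of degree greater than $2$; equivalently, it consists of a root vertex together with $f\ge 1$ paths (legs) $P_1,\dots,P_f$ starting at the root and otherwise pairwise vertex-disjoint. A $k$-spider $S_{\ell_1,\dots,\ell_f}$ is a spider whose legs have lengths (numbers of edges) $\ell_1,\dots,\ell_f\ge 1$ with $\ell_1+\dots+\ell_f=k$, i.e. a spider with $k$ edges. A graph contains a spider if it has a (not necessarily induced) subgraph isomorphic to it. A graph is hamiltonian if it has a cycle through all its vertices. -}

module Defs where

open import Data.Nat using (ℕ; zero; suc; _+_; _≤_; _<?_)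
open import Data.Bool using (Bool; true; false; T; if_then_else_)
open import Data.Fin using (Fin; zero; suc; toℕ; fromℕ<)
open import Data.List using (List; map; allFin)
open import Data.Nat.ListAction using (sum)
open import Data.Empty using (⊥)
open import Data.Vec as Vec using (Vec; lookup)
open import Data.Product using (Σ; Σ-syntax; _×_)
open import Relation.Nullary using (¬_; yes; no)
open import Relation.Binary.PropositionalEquality using (_≡_)
open import Function.Definitions using (Injective)

record SimpleGraph (n : ℕ) : Set where
  field
    adj    : Fin n → Fin n → Bool
    sym    : ∀ i j → adj i j ≡ adj j i
    irrefl : ∀ i → adj i i ≡ false

open SimpleGraph public

Adj : ∀ {n} → SimpleGraph n → Fin n → Fin n → Set
Adj G i j = T (adj G i j)

degree : ∀ {n} → SimpleGraph n → Fin n → ℕ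
degree {n} G x = sum (map (λ j → if adj G x j then 1 else 0) (allFin n))

record Subgraph {m n : ℕ} (H : SimpleGraph m) (G : SimpleGraph n) : Set where
  field
    emb     : Fin m → Fin n
    emb-inj : Injective _≡_ _≡_ emb
    emb-adj : ∀ i j → Adj H i j → Adj G (emb i) (emb j)

cycSucc : ∀ {m} → Fin (suc m) → Fin (suc m)
cycSucc {m} i with suc (toℕ i) <? suc m
... | yes p = fromℕ< p
... | no _  = zero

-- hamiltonian: a cycle (length ≥ 3) through all vertices, given as a
-- cyclic ordering σ (a bijection Fin m → Fin m) of the vertices in which
-- consecutive vertices (cyclically) are adjacent.
Hamiltonian : ∀ {m} → SimpleGraph m → Set
Hamiltonian {zero}  H = ⊥
Hamiltonian {suc m} H =
  (3 ≤ suc m) ×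
  Σ[ σ ∈ (Fin (suc m) → Fin (suc m)) ]
    (Injective _≡_ _≡_ σ × (∀ i → Adj H (σ i) (σ (cycSucc i))))

-- A k-spider S_{ℓ_1,…,ℓ_f}: f ≥ 1 legs, each of length ≥ 1, total length k.
IsSpiderShape : ℕ → {f : ℕ} → Vec ℕ f → Set
IsSpiderShape k {f} ℓ =
  (1 ≤ f) × (∀ i → 1 ≤ lookup ℓ i) × (Vec.sum ℓ ≡ k)

-- G contains the spider with leg lengths ℓ: a root vertex r and, for each
-- leg i, a path r, v(i,0), v(i,1), …, v(i,ℓ_i - 1) in G, where all these
-- vertices are pairwise distinct (legs are paths, pairwise vertex-disjoint
-- apart from the root).
ContainsSpider : ∀ {n f} → SimpleGraph n → Vec ℕ f → Set
ContainsSpider {n} {f} G ℓ =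
  Σ[ r ∈ Fin n ]
  Σ[ v ∈ (Σ[ i ∈ Fin f ] Fin (lookup ℓ i) → Fin n) ]
    ( Injective _≡_ _≡_ v
    × (∀ p → ¬ (v p ≡ r))
    × (∀ i (z : Fin (lookup ℓ i)) → toℕ z ≡ 0 → Adj G r (v (i Data.Product., z)))
    × (∀ i (a b : Fin (lookup ℓ i)) → suc (toℕ a) ≡ toℕ b →
         Adj G (v (i Data.Product., a)) (v (i Data.Product., b))) )

module Submission where

-- Walk once around the hamiltonian cycle starting at x₀: this visits the
-- vertices c₀ = x₀, c₁, …, c_{m-1} in order, each adjacent to the next.
-- Since x₀ has ≥ k neighbours, all among c₁, …, c_{m-1}, we can pick positions
-- 0 = p₀ < p₁ < … < p_k < m with every c_{p_j} (j ≥ 1) adjacent to x₀.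
-- Leg i of the spider gets the block of selection indices (o_i, o_i + ℓ_i],
-- where o_i = ℓ₁ + … + ℓ_{i-1}; it jumps from x₀ to c_{p_{o_i+ℓ_i}} and walks
-- the cycle backwards for ℓ_i - 1 further steps.  As p_{o_i+ℓ_i} - p_{o_i} ≥ ℓ_i
-- it stays strictly above p_{o_i}, so distinct legs use disjoint stretches.

open import Defs hiding (sym)
open import Data.Nat using (ℕ; NonZero; zero; suc; _+_; _∸_; _≤_; _<_; z≤n; s≤s; pred; >-nonZero; _<?_; _%_)
open import Data.Nat.Properties hiding (_≟_; <-cmp)
open import Data.Nat.DivMod using (m%n<n; m<n⇒m%n≡m; n%n≡0; m%n%n≡m%n; [m+n]%n≡m%n; %-distribˡ-+)
open import Data.Nat.ListAction using () renaming (sum to listSum)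
open import Data.Bool using (Bool; true; false; not; if_then_else_; T)
open import Data.Unit using (tt)
open import Data.Fin using (Fin; zero; suc; toℕ; fromℕ<; punchIn; punchOut; _≟_)
open import Data.Fin.Properties
  using (punchOut-injective; punchIn-punchOut; toℕ-fromℕ<; toℕ-injective; toℕ<n; <-cmp)
  renaming (suc-injective to Fin-suc-injective)
open import Data.List using (map; tabulate)
open import Data.Vec as Vec using (Vec; _∷_; lookup)
open import Data.Product using (Σ-syntax; ∃; _×_; _,_; proj₁; proj₂)
open import Data.Empty using (⊥-elim)
open import Relation.Binary.PropositionalEquality
open import Relation.Binary.Definitions using (tri<; tri≈; tri>)
open import Relation.Nullary using (¬_; yes; no)
open import Relation.Nullary.Decidable using (isYes; toWitness; fromWitness)
open import Function using (_∘_; id)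
open import Function.Definitions using (Injective)
open import Algebra.Properties.CommutativeMonoid.Sum +-0-commutativeMonoid
  using (sum; sum-remove; sum-cong-≗)

indicator : Bool → ℕ
indicator b = if b then 1 else 0

count : ∀ {n} → (Fin n → Bool) → ℕ
count b = sum (indicator ∘ b)

listSum-map-tabulate : ∀ {n} {A : Set} (g : Fin n → A) (φ : A → ℕ) →
  listSum (map φ (tabulate g)) ≡ sum (φ ∘ g)
listSum-map-tabulate {zero}  g φ = refl
listSum-map-tabulate {suc n} g φ = cong (φ (g zero) +_) (listSum-map-tabulate (g ∘ suc) φ)

degree≡count : ∀ {n} (G : SimpleGraph n) (x : Fin n) → degree G x ≡ count (adj G x)
degree≡count G x = listSum-map-tabulate id (indicator ∘ adj G x)

-- Summing a nonnegative function along an injection h undercounts: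
-- remove the term at h 0 and recurse on h restricted, via punchOut, to Fin n.
sum-injective-≤ : ∀ {m n} (h : Fin m → Fin n) → Injective _≡_ _≡_ h →
  (g : Fin n → ℕ) → sum (g ∘ h) ≤ sum g
sum-injective-≤ {zero}          h h-inj g = z≤n
sum-injective-≤ {suc m} {zero}  h h-inj g with h zero
... | ()
sum-injective-≤ {suc m} {suc n} h h-inj g = begin
  g (h zero) + sum (g ∘ h ∘ suc)              ≡⟨ cong (g (h zero) +_) (sum-cong-≗ (cong g ∘ sym ∘ punchIn-punchOut ∘ h₀≢)) ⟩
  g (h zero) + sum (g ∘ punchIn (h zero) ∘ h′) ≤⟨ +-monoʳ-≤ (g (h zero)) (sum-injective-≤ h′ h′-inj (g ∘ punchIn (h zero))) ⟩
  g (h zero) + sum (g ∘ punchIn (h zero))      ≡⟨ sum-remove {i = h zero} g ⟨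
  sum g                                        ∎
  where
  open ≤-Reasoning
  h₀≢ : ∀ i → h zero ≢ h (suc i)
  h₀≢ i e with h-inj e
  ... | ()
  h′ : Fin m → Fin n
  h′ i = punchOut (h₀≢ i)
  h′-inj : Injective _≡_ _≡_ h′
  h′-inj {i} {j} e = Fin-suc-injective (h-inj (punchOut-injective (h₀≢ i) (h₀≢ j) e))

count-complement : ∀ {n} (b : Fin n → Bool) → count b + count (not ∘ b) ≡ n
count-complement {zero}  b = refl
count-complement {suc n} b with b zero | count-complement (b ∘ suc)
... | true  | e = cong suc e
... | false | e = trans (+-suc (count (b ∘ suc)) _) (cong suc e)

-- An injective self-map h of Fin n does not decrease counts: it does not
-- increase the count of the complement, and the two counts add up to n.
count-injective-≤ : ∀ {n} (h : Fin n → Fin n) → Injective _≡_ _≡_ h →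
  (b : Fin n → Bool) → count b ≤ count (b ∘ h)
count-injective-≤ {n} h h-inj b = +-cancelʳ-≤ (count (not ∘ b ∘ h)) _ _ (begin
  count b + count (not ∘ b ∘ h)       ≤⟨ +-monoʳ-≤ (count b) (sum-injective-≤ h h-inj (indicator ∘ not ∘ b)) ⟩
  count b + count (not ∘ b)           ≡⟨ count-complement b ⟩
  n                                   ≡⟨ count-complement (b ∘ h) ⟨
  count (b ∘ h) + count (not ∘ b ∘ h) ∎)
  where open ≤-Reasoning

count-positive : ∀ {n} (b : Fin n → Bool) (i : Fin n) → T (b i) → 1 ≤ count b
count-positive {suc n} b i bi = begin
  1                                         ≤⟨ indicator-true (b i) bi ⟩
  indicator (b i)                           ≤⟨ m≤m+n _ _ ⟩
  indicator (b i) + count (b ∘ punchIn i)   ≡⟨ sum-remove {i = i} (indicator ∘ b) ⟨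
  count b                                   ∎
  where
  open ≤-Reasoning
  indicator-true : ∀ c → T c → 1 ≤ indicator c
  indicator-true true _ = ≤-refl

count-witness : ∀ {n} (b : Fin n → Bool) → 1 ≤ count b → ∃ λ i → T (b i)
count-witness {zero}  b ()
count-witness {suc n} b pos with b zero in e
... | true  = zero , subst T (sym e) tt
... | false with count-witness (b ∘ suc) pos
...   | i , bi = suc i , bi

-- Pigeonhole: an injective self-map of Fin n hits every y (count the
-- elements equal to y before and after applying h).
injective⇒surjective : ∀ {n} (h : Fin n → Fin n) → Injective _≡_ _≡_ h →
  ∀ y → ∃ λ x → h x ≡ y
injective⇒surjective h h-inj y with count-witness (is-y ∘ h)
  (≤-trans (count-positive is-y y (fromWitness {a? = y ≟ y} refl)) (count-injective-≤ h h-inj is-y))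
  where
  is-y = λ i → isYes (i ≟ y)
... | x , hx≡y = x , toWitness {a? = h x ≟ y} hx≡y

toℕ-cycSucc : ∀ {M} (i : Fin (suc M)) → toℕ (cycSucc i) ≡ suc (toℕ i) % suc M
toℕ-cycSucc {M} i with suc (toℕ i) <? suc M
... | yes i+1<m = trans (toℕ-fromℕ< i+1<m) (sym (m<n⇒m%n≡m i+1<m))
... | no  i+1≮m = trans (sym (n%n≡0 (suc M)))
                        (cong (_% suc M) (sym (≤-antisym (toℕ<n i) (≮⇒≥ i+1≮m))))

%-absorbʳ : ∀ {m} .{{_ : NonZero m}} y x → (y + x % m) % m ≡ (y + x) % m
%-absorbʳ {m} y x = begin
  (y + x % m) % m         ≡⟨ %-distribˡ-+ y (x % m) m ⟩
  (y % m + x % m % m) % m ≡⟨ cong (λ z → (y % m + z) % m) (m%n%n≡m%n x m) ⟩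
  (y % m + x % m) % m     ≡⟨ %-distribˡ-+ y x m ⟨
  (y + x) % m             ∎
  where open ≡-Reasoning

module Rotation (M : ℕ) (a : Fin (suc M)) where
  private m = suc M

  shift : ℕ → Fin m
  shift t = fromℕ< (m%n<n (toℕ a + t) m)

  toℕ-shift : ∀ t → toℕ (shift t) ≡ (toℕ a + t) % m
  toℕ-shift t = toℕ-fromℕ< _

  shift-zero : shift 0 ≡ a
  shift-zero = toℕ-injective (begin
    toℕ (shift 0)        ≡⟨ toℕ-shift 0 ⟩
    (toℕ a + 0) % m      ≡⟨ cong (_% m) (+-identityʳ (toℕ a)) ⟩
    toℕ a % m            ≡⟨ m<n⇒m%n≡m (toℕ<n a) ⟩
    toℕ a                ∎)
    where open ≡-Reasoning

  shift-suc : ∀ t → cycSucc (shift t) ≡ shift (suc t)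
  shift-suc t = toℕ-injective (begin
    toℕ (cycSucc (shift t))   ≡⟨ toℕ-cycSucc (shift t) ⟩
    suc (toℕ (shift t)) % m   ≡⟨ cong (λ y → suc y % m) (toℕ-shift t) ⟩
    (1 + (toℕ a + t) % m) % m ≡⟨ %-absorbʳ {m} 1 (toℕ a + t) ⟩
    suc (toℕ a + t) % m       ≡⟨ cong (_% m) (+-suc (toℕ a) t) ⟨
    (toℕ a + suc t) % m       ≡⟨ toℕ-shift (suc t) ⟨
    toℕ (shift (suc t))       ∎)
    where open ≡-Reasoning

  -- Subtracting a again (adding m ∸ a) recovers t < m from shift t.
  unshift : ∀ t → t < m → (m ∸ toℕ a + toℕ (shift t)) % m ≡ t
  unshift t t<m = begin
    (m ∸ toℕ a + toℕ (shift t)) % m   ≡⟨ cong (λ y → (m ∸ toℕ a + y) % m) (toℕ-shift t) ⟩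
    (m ∸ toℕ a + (toℕ a + t) % m) % m ≡⟨ %-absorbʳ {m} (m ∸ toℕ a) (toℕ a + t) ⟩
    (m ∸ toℕ a + (toℕ a + t)) % m     ≡⟨ cong (_% m) (+-assoc (m ∸ toℕ a) (toℕ a) t) ⟨
    (m ∸ toℕ a + toℕ a + t) % m       ≡⟨ cong (λ y → (y + t) % m) (m∸n+n≡m (<⇒≤ (toℕ<n a))) ⟩
    (m + t) % m                       ≡⟨ cong (_% m) (+-comm m t) ⟩
    (t + m) % m                       ≡⟨ [m+n]%n≡m%n t m ⟩
    t % m                             ≡⟨ m<n⇒m%n≡m t<m ⟩
    t                                 ∎
    where open ≡-Reasoning

  shift-injective : ∀ {t t′} → t < m → t′ < m → shift t ≡ shift t′ → t ≡ t′
  shift-injective {t} {t′} t<m t′<m e = begin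
    t                                  ≡⟨ unshift t t<m ⟨
    (m ∸ toℕ a + toℕ (shift t)) % m    ≡⟨ cong (λ i → (m ∸ toℕ a + toℕ i) % m) e ⟩
    (m ∸ toℕ a + toℕ (shift t′)) % m   ≡⟨ unshift t′ t′<m ⟩
    t′                                 ∎
    where open ≡-Reasoning

record HamiltonianWalk {m} (H : SimpleGraph m) (x₀ : Fin m) : Set where
  field
    walk           : ℕ → Fin m
    walk-start     : walk 0 ≡ x₀
    walk-adj       : ∀ t → Adj H (walk t) (walk (suc t))
    walk-injective : ∀ {t t′} → t < m → t′ < m → walk t ≡ walk t′ → t ≡ t′

-- Every vertex x₀ of a hamiltonian graph starts such a walk: the cyclic
-- ordering σ is onto, so x₀ = σ a, and we traverse σ from position a.
hamiltonianWalk : ∀ {m} (H : SimpleGraph m) → Hamiltonian H → (x₀ : Fin m) → HamiltonianWalk H x₀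
hamiltonianWalk {suc M} H (_ , σ , σ-inj , σ-adj) x₀ = record
  { walk           = σ ∘ shift
  ; walk-start     = trans (cong σ shift-zero) σa≡x₀
  ; walk-adj       = λ t → subst (λ i → Adj H (σ (shift t)) (σ i)) (shift-suc t) (σ-adj (shift t))
  ; walk-injective = λ t<m t′<m e → shift-injective t<m t′<m (σ-inj e)
  }
  where
  a : Fin (suc M)
  a = proj₁ (injective⇒surjective σ σ-inj x₀)
  σa≡x₀ : σ a ≡ x₀
  σa≡x₀ = proj₂ (injective⇒surjective σ σ-inj x₀)
  open Rotation M a

-- The number of positions t ∈ {1, …, n} at which P holds.
countPos : (ℕ → Bool) → ℕ → ℕ
countPos P n = count {n} (λ t → P (suc (toℕ t)))

StrictlyIncreasingUpTo : ℕ → (ℕ → ℕ) → Set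
StrictlyIncreasingUpTo k p = ∀ j → j < k → p j < p (suc j)

record Selection (P : ℕ → Bool) (n k : ℕ) : Set where
  field
    pick            : ℕ → ℕ
    pick-zero       : pick 0 ≡ 0
    pick-increasing : StrictlyIncreasingUpTo k pick
    pick-satisfies  : ∀ j → j < k → T (P (pick (suc j)))
    pick-bounded    : ∀ j → j ≤ k → pick j ≤ n

emptySelection : ∀ {P n} → Selection P n 0
emptySelection = record
  { pick = λ _ → 0 ; pick-zero = refl ; pick-increasing = λ _ ()
  ; pick-satisfies = λ _ () ; pick-bounded = λ _ _ → z≤n }

-- If P holds at ≥ k positions in {1, …, n}, a selection exists: greedily
-- take position 1 when P holds there, and shift a selection for P ∘ suc.
select : ∀ n (P : ℕ → Bool) k → k ≤ countPos P n → Selection P n k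
select zero P zero _ = emptySelection
select (suc n) P k k≤ with P 1 in P1
select (suc n) P k k≤ | false = record
  { pick = pick′ ; pick-zero = refl ; pick-increasing = increasing′
  ; pick-satisfies = pick-satisfies ; pick-bounded = bounded′ }
  where
  open Selection (select n (P ∘ suc) k k≤)
  pick′ : ℕ → ℕ
  pick′ zero    = 0
  pick′ (suc j) = suc (pick (suc j))
  increasing′ : StrictlyIncreasingUpTo k pick′
  increasing′ zero    _   = s≤s z≤n
  increasing′ (suc j) j<k = s≤s (pick-increasing (suc j) j<k)
  bounded′ : ∀ j → j ≤ k → pick′ j ≤ suc n
  bounded′ zero    _   = z≤n
  bounded′ (suc j) j+1≤k = s≤s (pick-bounded (suc j) j+1≤k)
select (suc n) P zero _ | true = emptySelection
select (suc n) P (suc k) (s≤s k≤) | true = record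
  { pick = pick′ ; pick-zero = refl ; pick-increasing = increasing′
  ; pick-satisfies = satisfies′ ; pick-bounded = bounded′ }
  where
  open Selection (select n (P ∘ suc) k k≤)
  pick′ : ℕ → ℕ
  pick′ zero    = 0
  pick′ (suc j) = suc (pick j)
  increasing′ : StrictlyIncreasingUpTo (suc k) pick′
  increasing′ zero    _         = s≤s z≤n
  increasing′ (suc j) (s≤s j<k) = s≤s (pick-increasing j j<k)
  satisfies′ : ∀ j → j < suc k → T (P (pick′ (suc j)))
  satisfies′ zero    _         = subst (λ y → T (P (suc y))) (sym pick-zero) (subst T (sym P1) _)
  satisfies′ (suc j) (s≤s j<k) = pick-satisfies j j<k
  bounded′ : ∀ j → j ≤ suc k → pick′ j ≤ suc n
  bounded′ zero    _         = z≤n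
  bounded′ (suc j) (s≤s j≤k) = s≤s (pick-bounded j j≤k)

increasing⇒spread : ∀ {k p} → StrictlyIncreasingUpTo k p →
  ∀ a b → a + b ≤ k → p a + b ≤ p (a + b)
increasing⇒spread {k} {p} inc a zero    _ = ≤-reflexive (trans (+-identityʳ (p a)) (cong p (sym (+-identityʳ a))))
increasing⇒spread {k} {p} inc a (suc b) le = begin
  p a + suc b       ≡⟨ +-suc (p a) b ⟩
  suc (p a + b)     ≤⟨ s≤s (increasing⇒spread inc a b (≤-trans (n≤1+n (a + b)) a+b<k)) ⟩
  suc (p (a + b))   ≤⟨ inc (a + b) a+b<k ⟩
  p (suc (a + b))   ≡⟨ cong p (+-suc a b) ⟨
  p (a + suc b)     ∎
  where
  open ≤-Reasoning
  a+b<k : a + b < k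
  a+b<k = ≤-trans (≤-reflexive (sym (+-suc a b))) le

increasing⇒monotone : ∀ {k p} → StrictlyIncreasingUpTo k p →
  ∀ {a a′} → a ≤ a′ → a′ ≤ k → p a ≤ p a′
increasing⇒monotone {k} {p} inc {a} {a′} a≤a′ a′≤k = begin
  p a                  ≤⟨ m≤m+n (p a) (a′ ∸ a) ⟩
  p a + (a′ ∸ a)       ≤⟨ increasing⇒spread inc a (a′ ∸ a) (≤-trans (≤-reflexive a+[a′∸a]≡a′) a′≤k) ⟩
  p (a + (a′ ∸ a))     ≡⟨ cong p a+[a′∸a]≡a′ ⟩
  p a′                 ∎
  where
  open ≤-Reasoning
  a+[a′∸a]≡a′ : a + (a′ ∸ a) ≡ a′
  a+[a′∸a]≡a′ = m+[n∸m]≡n a≤a′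

-- Along a hamiltonian walk from x₀, the neighbours of x₀ all occur at
-- positions 1, …, m-1 (position 0 is x₀ itself, and H has no loops).
degree-≤-countPos : ∀ {M} (H : SimpleGraph (suc M)) {x₀} (w : HamiltonianWalk H x₀) →
  degree H x₀ ≤ countPos (λ t → adj H x₀ (HamiltonianWalk.walk w t)) M
degree-≤-countPos {M} H {x₀} w = begin
  degree H x₀                                       ≡⟨ degree≡count H x₀ ⟩
  count (adj H x₀)                                  ≤⟨ count-injective-≤ walkFin walkFin-injective (adj H x₀) ⟩
  count (adj H x₀ ∘ walkFin)                        ≡⟨ cong (λ b → indicator b + countPos isNeighbour M) x₀≁x₀ ⟩
  countPos isNeighbour M                            ∎
  where
  open ≤-Reasoning
  open HamiltonianWalk w
  isNeighbour : ℕ → Bool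
  isNeighbour t = adj H x₀ (walk t)
  walkFin : Fin (suc M) → Fin (suc M)
  walkFin t = walk (toℕ t)
  walkFin-injective : Injective _≡_ _≡_ walkFin
  walkFin-injective {t} {t′} e = toℕ-injective (walk-injective (toℕ<n t) (toℕ<n t′) e)
  x₀≁x₀ : adj H x₀ (walk 0) ≡ false
  x₀≁x₀ = trans (cong (adj H x₀) walk-start) (irrefl H x₀)

-- offset ℓ i = ℓ₀ + … + ℓ_{i-1}: leg i occupies the selection indices
-- (offset ℓ i, legEnd ℓ i].
offset : ∀ {f} → Vec ℕ f → Fin f → ℕ
offset (x ∷ xs) zero    = 0
offset (x ∷ xs) (suc i) = x + offset xs i

legEnd : ∀ {f} → Vec ℕ f → Fin f → ℕ
legEnd ℓ i = offset ℓ i + lookup ℓ i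

legEnd-≤-sum : ∀ {f} (ℓ : Vec ℕ f) i → legEnd ℓ i ≤ Vec.sum ℓ
legEnd-≤-sum (x ∷ xs) zero    = m≤m+n x _
legEnd-≤-sum (x ∷ xs) (suc i) = ≤-trans (≤-reflexive (+-assoc x (offset xs i) _)) (+-monoʳ-≤ x (legEnd-≤-sum xs i))

legEnd-≤-offset : ∀ {f} (ℓ : Vec ℕ f) i i′ → toℕ i < toℕ i′ → legEnd ℓ i ≤ offset ℓ i′
legEnd-≤-offset (x ∷ xs) zero    (suc i′) _         = m≤m+n x _
legEnd-≤-offset (x ∷ xs) (suc i) (suc i′) (s≤s i<i′) =
  ≤-trans (≤-reflexive (+-assoc x (offset xs i) _)) (+-monoʳ-≤ x (legEnd-≤-offset xs i i′ i<i′))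

offset-≤-sum : ∀ {f} (ℓ : Vec ℕ f) i → offset ℓ i ≤ Vec.sum ℓ
offset-≤-sum ℓ i = m+n≤o⇒m≤o (offset ℓ i) (legEnd-≤-sum ℓ i)

Adj-sym : ∀ {n} (G : SimpleGraph n) {i j} → Adj G i j → Adj G j i
Adj-sym G {i} {j} = subst T (SimpleGraph.sym G i j)

module SpiderAlongWalk
  {M : ℕ} (H : SimpleGraph (suc M)) {x₀ : Fin (suc M)} (w : HamiltonianWalk H x₀)
  {k : ℕ} (s : Selection (λ t → adj H x₀ (HamiltonianWalk.walk w t)) M k)
  {f : ℕ} (ℓ : Vec ℕ f) (legs-positive : ∀ i → 1 ≤ lookup ℓ i) (legs-total : Vec.sum ℓ ≡ k)
  where
  open HamiltonianWalk w
  open Selection s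

  Node : Set
  Node = Σ[ i ∈ Fin f ] Fin (lookup ℓ i)

  legEnd-≤-k : ∀ i → legEnd ℓ i ≤ k
  legEnd-≤-k i = ≤-trans (legEnd-≤-sum ℓ i) (≤-reflexive legs-total)

  leg-room : ∀ i → pick (offset ℓ i) + lookup ℓ i ≤ pick (legEnd ℓ i)
  leg-room i = increasing⇒spread pick-increasing (offset ℓ i) (lookup ℓ i) (legEnd-≤-k i)

  position : Node → ℕ
  position (i , z) = pick (legEnd ℓ i) ∸ toℕ z

  position-<-m : ∀ q → position q < suc M
  position-<-m (i , z) = s≤s (≤-trans (m∸n≤m _ (toℕ z)) (pick-bounded (legEnd ℓ i) (legEnd-≤-k i)))

  -- The subtraction defining a position never truncates.
  z-≤-end : ∀ i (z : Fin (lookup ℓ i)) → toℕ z ≤ pick (legEnd ℓ i)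
  z-≤-end i z = ≤-trans (<⇒≤ (toℕ<n z)) (m+n≤o⇒n≤o _ (leg-room i))

  position-above-start : ∀ i z → pick (offset ℓ i) < position (i , z)
  position-above-start i z = m+n≤o⇒m≤o∸n (suc (pick (offset ℓ i)))
    (≤-trans (≤-reflexive (sym (+-suc _ (toℕ z)))) (≤-trans (+-monoʳ-≤ _ (toℕ<n z)) (leg-room i)))

  earlier-leg-below : ∀ i z i′ z′ → toℕ i < toℕ i′ → position (i , z) < position (i′ , z′)
  earlier-leg-below i z i′ z′ i<i′ = begin-strict
    position (i , z)     ≤⟨ m∸n≤m _ (toℕ z) ⟩
    pick (legEnd ℓ i)    ≤⟨ increasing⇒monotone pick-increasing (legEnd-≤-offset ℓ i i′ i<i′)
                              (≤-trans (offset-≤-sum ℓ i′) (≤-reflexive legs-total)) ⟩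
    pick (offset ℓ i′)   <⟨ position-above-start i′ z′ ⟩
    position (i′ , z′)   ∎
    where open ≤-Reasoning

  position-injective : ∀ {q q′} → position q ≡ position q′ → q ≡ q′
  position-injective {i , z} {i′ , z′} e with <-cmp i i′
  ... | tri< i<i′ _ _ = ⊥-elim (<-irrefl e (earlier-leg-below i z i′ z′ i<i′))
  ... | tri> _ _ i>i′ = ⊥-elim (<-irrefl (sym e) (earlier-leg-below i′ z′ i z i>i′))
  ... | tri≈ _ refl _ = cong (i ,_) (toℕ-injective (∸-cancelˡ-≡ (z-≤-end i z) (z-≤-end i z′) e))

  vertex : Node → Fin (suc M)
  vertex = walk ∘ position

  vertex-injective : Injective _≡_ _≡_ vertex
  vertex-injective {q} {q′} e = position-injective (walk-injective (position-<-m q) (position-<-m q′) e)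

  -- No node is the root, which sits at position 0.
  vertex-≢-root : ∀ q → ¬ (vertex q ≡ x₀)
  vertex-≢-root (i , z) e = <-irrefl (sym (walk-injective (position-<-m (i , z)) (s≤s z≤n) (trans e (sym walk-start))))
                                     (≤-<-trans z≤n (position-above-start i z))

  -- The first node of leg i is the selected neighbour pick (legEnd ℓ i).
  root-adj : ∀ i (z : Fin (lookup ℓ i)) → toℕ z ≡ 0 → Adj H x₀ (vertex (i , z))
  root-adj i z z≡0 rewrite z≡0 = subst (λ j → T (adj H x₀ (walk (pick j)))) end≡ (pick-satisfies _ end-1<k)
    where
    end≡ : suc (pred (legEnd ℓ i)) ≡ legEnd ℓ i
    end≡ = suc-pred (legEnd ℓ i) {{>-nonZero (≤-trans (legs-positive i) (m≤n+m _ _))}}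
    end-1<k : pred (legEnd ℓ i) < k
    end-1<k = ≤-trans (≤-reflexive end≡) (legEnd-≤-k i)

  -- Node a+1 precedes node a on the walk, so they are adjacent.
  leg-adj : ∀ i (a b : Fin (lookup ℓ i)) → suc (toℕ a) ≡ toℕ b → Adj H (vertex (i , a)) (vertex (i , b))
  leg-adj i a b a+1≡b = Adj-sym H (subst (Adj H (vertex (i , b)) ∘ walk) (sym a-follows-b) (walk-adj (position (i , b))))
    where
    open ≡-Reasoning
    end = pick (legEnd ℓ i)
    a-follows-b : position (i , a) ≡ suc (position (i , b))
    a-follows-b = begin
      end ∸ toℕ a             ≡⟨⟩
      suc end ∸ suc (toℕ a)   ≡⟨ cong (suc end ∸_) a+1≡b ⟩
      suc end ∸ toℕ b         ≡⟨ +-∸-assoc 1 (z-≤-end i b) ⟩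
      suc (end ∸ toℕ b)       ∎

  spider : ContainsSpider H ℓ
  spider = x₀ , vertex , vertex-injective , vertex-≢-root , root-adj , leg-adj

spider-in-supergraph : ∀ {m n f} {H : SimpleGraph m} {G : SimpleGraph n} → Subgraph H G →
  (ℓ : Vec ℕ f) → ContainsSpider H ℓ → ContainsSpider G ℓ
spider-in-supergraph S ℓ (r , v , v-inj , v≢r , r-adj , v-adj) =
  emb r , emb ∘ v , v-inj ∘ emb-inj , (λ q → v≢r q ∘ emb-inj) ,
  (λ i z z≡0 → emb-adj _ _ (r-adj i z z≡0)) , (λ i a b a+1≡b → emb-adj _ _ (v-adj i a b a+1≡b))
  where open Subgraph S

spider-in-hamiltonian : ∀ {m} (H : SimpleGraph m) → Hamiltonian H → ∀ {k} →
  (Σ[ x₀ ∈ Fin m ] (k ≤ degree H x₀)) → ∀ {f} (ℓ : Vec ℕ f) → IsSpiderShape k ℓ → ContainsSpider H ℓ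
spider-in-hamiltonian {zero}  H () _ _ _
spider-in-hamiltonian {suc M} H ham {k} (x₀ , k≤deg) ℓ (_ , legs-positive , legs-total) =
  SpiderAlongWalk.spider H w neighbours ℓ legs-positive legs-total
  where
  w : HamiltonianWalk H x₀
  w = hamiltonianWalk H ham x₀
  neighbours : Selection (λ t → adj H x₀ (HamiltonianWalk.walk w t)) M k
  neighbours = select M _ k (≤-trans k≤deg (degree-≤-countPos H w))

theorem1 : (k : ℕ) → 1 ≤ k → {n m : ℕ} (G : SimpleGraph n) (H : SimpleGraph m) → Subgraph H G → Hamiltonian H → (Σ[ x₀ ∈ Fin m ] (k ≤ degree H x₀)) → {f : ℕ} (ℓ : Vec ℕ f) → IsSpiderShape k ℓ → ContainsSpider H ℓ × ContainsSpider G ℓ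
theorem1 k _ G H H⊆G ham x₀ ℓ shape = inH , spider-in-supergraph H⊆G ℓ inH
  where
  inH : ContainsSpider H ℓ
  inH = spider-in-hamiltonian H ham x₀ ℓ shape
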